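{- Let $m\geqslant4$ be even and let $H$, $h$, $x$, $y$, $z$ be as in the context, and $U=\{\prod_{i=1}^{m-3}c_i^{k_i} : k_i\in\{0,1\},\ \sum_{j=1}^{(m-4)/2}k_{2j}\equiv k_{m-3}\pmod 2\}$. Then for each $g\in H\setminus U$ there exists $\zeta\in\langle x,y,z\rangle$ such that $g^\zeta=h$.
   Context: Permutations act on the right, written exponentially, and a product $\sigma\rho$ means first $\sigma$ then $\rho$. Let $m\geqslant4$ be even and $H=\langle a,b\mid a^4=b^2=(ab)^2=1\rangle\times\langle c_1\rangle\times\cdots\times\langle c_{m-3}\rangle$, where $c_1,\dots,c_{m-3}$ are involutions. Put $c_{ -1}=c_0=1$. Let $K=\langle a^2,b,c_1,\dots,c_{m-3}\rangle$ and $h=a\prod_{i=0}^{(m-4)/2}c_{2i+1}$. Let $x\in\mathrm{Aut}(H)$ be defined by $a^x=a^{ -1}$, $b^x=ab$, $c_{2i+1}^x=c_{2i+1}$, $c_{2i+2}^x=a^2c_{2i+1}c_{2i+2}$ for $0\leqslant i\leqslant(m-6)/2$, and $c_{m-3}^x=a^2c_{m-3}$. Let $\tau\in\mathrm{Aut}(K)$ be defined by $(a^2)^\tau=b$, $b^\tau=a^2$, $c_{2i+1}^\tau=c_{2i-1}c_{2i}c_{2i+2}$, $c_{2i+2}^\tau=c_{2i-1}c_{2i}c_{2i+1}$ for $0\leqslant i\leqslant(m-6)/2$, and $c_{m-3}^\tau=c_{m-3}$. Let $R$ be the right regular representation of $H$ ($R(g):u\mapsto ug$). Let $y$ be the permutation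 of $H$ with $k^y=k^\tau$ and $(hk)^y=hk^\tau c_{m-3}$ for all $k\in K$, and $z=R(h)\,y\,R(h^{ -1}c_{m-3})$. -}

module Defs where

open import Data.Nat using (ℕ; zero; suc; _+_; _*_; _∸_; _≡ᵇ_; _/_; _%_)
open import Data.Nat.DivMod using (m%n<n)
open import Data.Fin using (Fin; toℕ; fromℕ<) renaming (zero to fz; suc to fs)
open import Data.Bool using (Bool; true; false; if_then_else_; _xor_; _∧_)
open import Data.Vec using (Vec; []; _∷_; zipWith; replicate; tabulate)
open import Data.List using (List; upTo; map; foldr)
open import Data.Nat.ListAction using (sum)
open import Data.Product using (Σ; _×_)
open import Relation.Binary.PropositionalEquality using (_≡_)

-- Arithmetic in ℤ/4 (exponents of a), represented by Fin 4

add4 : Fin 4 → Fin 4 → Fin 4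
add4 i k = fromℕ< (m%n<n (toℕ i + toℕ k) 4)

neg4 : Fin 4 → Fin 4
neg4 i = fromℕ< (m%n<n (4 ∸ toℕ i) 4)

b2n : Bool → ℕ
b2n true  = 1
b2n false = 0

-- H = D8 × C2^n, with D8 = ⟨a,b | a^4 = b^2 = (ab)^2 = 1⟩.
-- The element ⟪ i , j , v ⟫ is the normal form  a^i b^j c_1^{v_1} ⋯ c_n^{v_n}
-- (coordinate (k : Fin n) of v is the exponent of c_{toℕ k + 1}).

record H (n : ℕ) : Set where
  constructor ⟪_,_,_⟫
  field
    ex : Fin 4
    fl : Bool
    cv : Vec Bool n
open H public

module _ {n : ℕ} where

  -- (a^i b^j)(a^k b^l) = a^(i ± k) b^(j+l), using b a^k = a^(-k) b
  _·_ : H n → H n → H n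
  ⟪ i , j , v ⟫ · ⟪ k , l , w ⟫ =
    ⟪ add4 i (if j then neg4 k else k) , j xor l , zipWith _xor_ v w ⟫

  one : H n
  one = ⟪ fz , false , replicate n false ⟫

  inv : H n → H n
  inv ⟪ i , j , v ⟫ = ⟪ (if j then i else neg4 i) , j , v ⟫

  pow : H n → ℕ → H n
  pow g zero    = one
  pow g (suc k) = g · pow g k

  gA : H n
  gA = ⟪ fs fz , false , replicate n false ⟫

  gB : H n
  gB = ⟪ fz , true , replicate n false ⟫

  gA2 : H n
  gA2 = gA · gA

  -- c_k for 1 ≤ k ≤ n; c_k = 1 for k outside this range (in particular c_0 = 1)
  cc : ℕ → H n
  cc k = ⟪ fz , false , tabulate (λ j → suc (toℕ j) ≡ᵇ k) ⟫

  prodC : ∀ {r} → (Fin r → H n) → Vec Bool r → H n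
  prodC f []          = one
  prodC f (true ∷ v)  = f fz · prodC (λ k → f (fs k)) v
  prodC f (false ∷ v) = prodC (λ k → f (fs k)) v

  -- the homomorphism H → H sending a ↦ A, b ↦ B, c_k ↦ C k
  -- (applied to the normal form a^i b^j ∏ c_k^{v_k})
  homH : H n → H n → (Fin n → H n) → H n → H n
  homH A B C g = pow A (toℕ (ex g)) · (pow B (b2n (fl g)) · prodC C (cv g))

  -- membership in K = ⟨a^2, b, c_1, …, c_n⟩ (i.e. the exponent of a is even)
  inK : H n → Bool
  inK g = toℕ (ex g) % 2 ≡ᵇ 0

HH : ℕ → Set
HH m = H (m ∸ 3)

cgen : (m : ℕ) → Fin (m ∸ 3) → HH m
cgen m i = cc (suc (toℕ i))

hh : (m : ℕ) → HH m
hh m = gA · foldr (λ i acc → cc (2 * i + 1) · acc) one (upTo ((m ∸ 4) / 2 + 1))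

xC : (m : ℕ) → ℕ → HH m
xC m k =
  if k ≡ᵇ m ∸ 3 then gA2 · cc k
  else if k % 2 ≡ᵇ 1 then cc k
  else (gA2 · cc (k ∸ 1)) · cc k

xAut : (m : ℕ) → HH m → HH m
xAut m = homH (inv gA) (gA · gB) (λ i → xC m (suc (toℕ i)))

-- image of c_k under τ (1 ≤ k ≤ m-3), with c_{-1} = c_0 = 1:
--   c_{m-3} ↦ c_{m-3};
--   c_{2i+1} ↦ c_{2i-1} c_{2i} c_{2i+2};  c_{2i+2} ↦ c_{2i-1} c_{2i} c_{2i+1}
-- (2i ∸ 1 = 0 when i = 0, and cc 0 = 1, realising c_{-1} = 1)
τC : (m : ℕ) → ℕ → HH m
τC m k =
  if k ≡ᵇ m ∸ 3 then cc k
  else if k % 2 ≡ᵇ 1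
    then (let i = k / 2 in (cc (2 * i ∸ 1) · cc (2 * i)) · cc (2 * i + 2))
    else (let i = (k ∸ 2) / 2 in (cc (2 * i ∸ 1) · cc (2 * i)) · cc (2 * i + 1))

-- τ ∈ Aut(K): a^2 ↦ b, b ↦ a^2, c_k ↦ τC m k
-- (applied to k = a^{2e} b^j ∏ c_k^{v_k} ∈ K)
τK : (m : ℕ) → HH m → HH m
τK m g = pow gB (toℕ (ex g) / 2) · (pow gA2 (b2n (fl g)) · prodC (λ i → τC m (suc (toℕ i))) (cv g))

yPerm : (m : ℕ) → HH m → HH m
yPerm m g =
  if inK g then τK m g
  else (hh m · τK m (inv (hh m) · g)) · cc (m ∸ 3)

-- z = R(h) y R(h^{-1} c_{m-3})  (right actions: first R(h), then y, then R(h^{-1}c_{m-3}))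
zPerm : (m : ℕ) → HH m → HH m
zPerm m g = yPerm m (g · hh m) · (inv (hh m) · cc (m ∸ 3))

-- The subgroup ⟨x, y, z⟩ of Sym(H): permutations (as functions H → H)
-- obtained from x, y, z, id by composition and taking (two-sided) inverses.
-- comp f g is "first f then g", i.e. u ↦ g (f u)  (so u^(fg) = (u^f)^g).
data InXYZ (m : ℕ) : (HH m → HH m) → Set where
  gen-id : InXYZ m (λ u → u)
  gen-x  : InXYZ m (xAut m)
  gen-y  : InXYZ m (yPerm m)
  gen-z  : InXYZ m (zPerm m)
  gen-comp : ∀ {f g} → InXYZ m f → InXYZ m g → InXYZ m (λ u → g (f u))
  gen-inv  : ∀ {f g} → InXYZ m f →
             (∀ u → g (f u) ≡ u) → (∀ u → f (g u) ≡ u) → InXYZ m g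

-- bit v k = k-th coordinate (1-based) of v, i.e. the exponent of c_k
bit : ∀ {r} → Vec Bool r → ℕ → Bool
bit []      _             = false
bit (b ∷ v) zero          = false
bit (b ∷ v) (suc zero)    = b
bit (b ∷ v) (suc (suc k)) = bit v (suc k)

condU : (m : ℕ) → Vec Bool (m ∸ 3) → Set
condU m k =
  sum (map (λ j → b2n (bit k (2 * suc j))) (upTo ((m ∸ 4) / 2))) % 2
    ≡ b2n (bit k (m ∸ 3)) % 2

InU : (m : ℕ) → HH m → Set
InU m g = Σ (Vec Bool (m ∸ 3)) (λ k → condU m k × g ≡ prodC (cgen m) k)

module Submission where

-- Write every g ∈ H as d · v with d ∈ D8 = ⟨a, b⟩ and v in C = ⟨c_1, …, c_{m-3}⟩ ≅ (ℤ/2)^(m-3).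
-- On c-parts, x and y act through the linear involutions xc and τc, y adding moreover a fixed
-- vector δ to the c-part of elements outside K, while the D8-parts move by explicit permutations.
-- The words yz and xyzx fix the c-part and act transitively on D8 ∖ {1}.  Hence the set of
-- vectors c such that ⟨x, y, z⟩ maps every d · v with d ≠ 1 to a · (v + c) is a subspace stable
-- under xc and τc and containing δ, and these generate all of C.  So every g with non-trivial
-- D8-part is mapped to h = a · ∏_{j ≤ (m-4)/2} c_{2j+1}.  If the D8-part of g is trivial, x gives it
-- the D8-part a^(2 · xa v); and xa v = 0 is exactly the parity condition defining U.

open import Defs

open import Algebra.Bundles using (CommutativeMonoid; CommutativeRing)
open import Algebra.Structures using (IsCommutativeMonoid)
import Algebra.Properties.CommutativeSemigroup as CommutativeSemigroupProperties
import Algebra.Solver.Monoid.Expression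
import Algebra.Solver.Monoid.Solver as MonoidSolver
open import Data.Bool using (Bool; true; false; not; _xor_; if_then_else_)
open import Data.Bool.Properties
  using (_≟_; if-cong; xor-assoc; xor-comm; xor-same; xor-identityʳ; xor-∧-commutativeRing)
open import Data.Empty using (⊥-elim)
open import Data.Fin as Fin using (Fin; toℕ; fromℕ<)
open import Data.Fin.Patterns using (0F; 1F; 2F; 3F)
open import Data.Fin.Properties using (toℕ-fromℕ<; toℕ<n)
open import Data.List using (List; []; _∷_; foldr; map; upTo; applyUpTo)
open import Data.List.Properties using (map-applyUpTo; map-cong)
open import Data.Nat using (ℕ; zero; suc; _+_; _*_; _∸_; _/_; _%_; _≡ᵇ_; _≤_; _<_; z≤n; s≤s)
open import Data.Nat.DivMod using (m/n≡1+[m∸n]/n; %-distribˡ-+)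
open import Data.Nat.Divisibility using (_∣_; divides)
open import Data.Nat.ListAction using (sum)
open import Data.Nat.Properties
  using (+-suc; +-comm; *-suc; <⇒≤; ≤-refl; <-trans; n<1+n; m∸n+n≡m; m≤n+m)
open import Data.Product using (Σ; _×_; _,_)
open import Data.Vec using (Vec; []; _∷_; zipWith; replicate; lookup)
open import Data.Vec.Properties using (zipWith-assoc; zipWith-identityˡ; zipWith-identityʳ; ≡-dec)
open import Function using (_∘_)
open import Level using (0ℓ)
open import Relation.Binary.PropositionalEquality
  using (_≡_; _≢_; refl; sym; trans; cong; cong₂; subst; isEquivalence; module ≡-Reasoning)
open import Relation.Nullary using (¬_)

open ≡-Reasoning

-- Bit vectors and Boolean groups

Bits : ℕ → Set
Bits = Vec Bool

infixl 6 _⊕_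
_⊕_ : ∀ {n} → Bits n → Bits n → Bits n
_⊕_ = zipWith _xor_

0ᵇ : ∀ {n} → Bits n
0ᵇ = replicate _ false

⊕-identityˡ : ∀ {n} (v : Bits n) → 0ᵇ ⊕ v ≡ v
⊕-identityˡ = zipWith-identityˡ (λ _ → refl)

⊕-identityʳ : ∀ {n} (v : Bits n) → v ⊕ 0ᵇ ≡ v
⊕-identityʳ = zipWith-identityʳ xor-identityʳ

⊕-assoc : ∀ {n} (u v w : Bits n) → (u ⊕ v) ⊕ w ≡ u ⊕ (v ⊕ w)
⊕-assoc = zipWith-assoc xor-assoc

⊕-comm : ∀ {n} (v w : Bits n) → v ⊕ w ≡ w ⊕ v
⊕-comm []      []      = refl
⊕-comm (a ∷ v) (b ∷ w) = cong₂ _∷_ (xor-comm a b) (⊕-comm v w)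

⊕-self : ∀ {n} (v : Bits n) → v ⊕ v ≡ 0ᵇ
⊕-self []      = refl
⊕-self (a ∷ v) = cong₂ _∷_ (xor-same a) (⊕-self v)

foldr-⊕-applyUpTo-suc : ∀ {n} (f : ℕ → Bits n) (g : ℕ → ℕ) q →
  foldr (λ i acc → f i ⊕ acc) 0ᵇ (applyUpTo g (suc q)) ≡
  foldr (λ i acc → f i ⊕ acc) 0ᵇ (applyUpTo g q) ⊕ f (g q)
foldr-⊕-applyUpTo-suc f g zero    = trans (⊕-identityʳ _) (sym (⊕-identityˡ _))
foldr-⊕-applyUpTo-suc f g (suc q) =
  trans (cong (f (g 0) ⊕_) (foldr-⊕-applyUpTo-suc f (g ∘ suc) q)) (sym (⊕-assoc _ _ _))

record BooleanGroup : Set₁ where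
  infixl 7 _∙_
  field
    Carrier             : Set
    _∙_                 : Carrier → Carrier → Carrier
    ε                   : Carrier
    isCommutativeMonoid : IsCommutativeMonoid _≡_ _∙_ ε
    ∙-self              : ∀ x → x ∙ x ≡ ε

  commutativeMonoid : CommutativeMonoid 0ℓ 0ℓ
  commutativeMonoid = record { isCommutativeMonoid = isCommutativeMonoid }

  open CommutativeMonoid commutativeMonoid public
    using (assoc; comm; identityˡ; identityʳ; commutativeSemigroup; monoid)

xor-booleanGroup : BooleanGroup
xor-booleanGroup = record
  { Carrier             = Bool
  ; _∙_                 = _xor_
  ; ε                   = false
  ; isCommutativeMonoid = XorRing.+-isCommutativeMonoid
  ; ∙-self              = xor-same
  }
  where module XorRing = CommutativeRing xor-∧-commutativeRing

bits-booleanGroup : ℕ → BooleanGroup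
bits-booleanGroup n = record
  { Carrier             = Bits n
  ; _∙_                 = _⊕_
  ; ε                   = 0ᵇ
  ; isCommutativeMonoid = record
    { isMonoid = record
      { isSemigroup = record
        { isMagma = record { isEquivalence = isEquivalence ; ∙-cong = cong₂ _⊕_ }
        ; assoc   = ⊕-assoc
        }
      ; identity = ⊕-identityˡ , ⊕-identityʳ
      }
    ; comm = ⊕-comm
    }
  ; ∙-self              = ⊕-self
  }

unit : ∀ {n} → Fin n → Bits n
unit 0F          = true ∷ 0ᵇ
unit (Fin.suc i) = false ∷ unit i

cv-cc-zero : ∀ {n} → cv (cc {n} 0) ≡ 0ᵇ
cv-cc-zero {zero}  = refl
cv-cc-zero {suc n} = cong (false ∷_) (cv-cc-zero {n})

cv-cc-suc : ∀ {n} (i : Fin n) → cv (cc {n} (suc (toℕ i))) ≡ unit i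
cv-cc-suc 0F          = cong (true ∷_) cv-cc-zero
cv-cc-suc (Fin.suc i) = cong (false ∷_) (cv-cc-suc i)

module LinearCombination (G : BooleanGroup) where

  open BooleanGroup G
  open CommutativeSemigroupProperties commutativeSemigroup using (interchange; x∙yz≈y∙xz)

  linComb : ∀ {r} → (Fin r → Carrier) → Bits r → Carrier
  linComb c []          = ε
  linComb c (true ∷ v)  = c 0F ∙ linComb (c ∘ Fin.suc) v
  linComb c (false ∷ v) = linComb (c ∘ Fin.suc) v

  linComb-cong : ∀ {r} {c d : Fin r → Carrier} → (∀ i → c i ≡ d i) → ∀ v → linComb c v ≡ linComb d v
  linComb-cong c≗d []          = refl
  linComb-cong c≗d (true ∷ v)  = cong₂ _∙_ (c≗d 0F) (linComb-cong (c≗d ∘ Fin.suc) v)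
  linComb-cong c≗d (false ∷ v) = linComb-cong (c≗d ∘ Fin.suc) v

  linComb-0ᵇ : ∀ {r} (c : Fin r → Carrier) → linComb c 0ᵇ ≡ ε
  linComb-0ᵇ {zero}  c = refl
  linComb-0ᵇ {suc r} c = linComb-0ᵇ (c ∘ Fin.suc)

  linComb-ε : ∀ {r} (v : Bits r) → linComb (λ _ → ε) v ≡ ε
  linComb-ε []          = refl
  linComb-ε (true ∷ v)  = trans (identityˡ _) (linComb-ε v)
  linComb-ε (false ∷ v) = linComb-ε v

  linComb-unit : ∀ {r} (c : Fin r → Carrier) i → linComb c (unit i) ≡ c i
  linComb-unit c 0F          = trans (cong (c 0F ∙_) (linComb-0ᵇ (c ∘ Fin.suc))) (identityʳ (c 0F))
  linComb-unit c (Fin.suc i) = linComb-unit (c ∘ Fin.suc) i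

  linComb-⊕ : ∀ {r} (c : Fin r → Carrier) v w → linComb c (v ⊕ w) ≡ linComb c v ∙ linComb c w
  linComb-⊕ c []          []          = sym (identityˡ ε)
  linComb-⊕ c (false ∷ v) (false ∷ w) = linComb-⊕ (c ∘ Fin.suc) v w
  linComb-⊕ c (false ∷ v) (true ∷ w)  = begin
    c 0F ∙ L (v ⊕ w)            ≡⟨ cong (c 0F ∙_) (linComb-⊕ (c ∘ Fin.suc) v w) ⟩
    c 0F ∙ (L v ∙ L w)          ≡⟨ x∙yz≈y∙xz _ _ _ ⟩
    L v ∙ (c 0F ∙ L w)          ∎
    where L = linComb (c ∘ Fin.suc)
  linComb-⊕ c (true ∷ v)  (false ∷ w) = begin
    c 0F ∙ L (v ⊕ w)            ≡⟨ cong (c 0F ∙_) (linComb-⊕ (c ∘ Fin.suc) v w) ⟩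
    c 0F ∙ (L v ∙ L w)          ≡⟨ assoc _ _ _ ⟨
    c 0F ∙ L v ∙ L w            ∎
    where L = linComb (c ∘ Fin.suc)
  linComb-⊕ c (true ∷ v)  (true ∷ w)  = begin
    L (v ⊕ w)                   ≡⟨ linComb-⊕ (c ∘ Fin.suc) v w ⟩
    L v ∙ L w                   ≡⟨ identityˡ _ ⟨
    ε ∙ (L v ∙ L w)             ≡⟨ cong (_∙ (L v ∙ L w)) (∙-self (c 0F)) ⟨
    (c 0F ∙ c 0F) ∙ (L v ∙ L w) ≡⟨ interchange _ _ _ _ ⟩
    (c 0F ∙ L v) ∙ (c 0F ∙ L w) ∎
    where L = linComb (c ∘ Fin.suc)

  linComb-cv-cc : ∀ {n} (f : ℕ → Carrier) t → t < n →
                  linComb (λ i → f (suc (toℕ i))) (cv (cc {n} (suc t))) ≡ f (suc t)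
  linComb-cv-cc f t t<n = begin
    linComb f′ (cv (cc (suc t)))              ≡⟨ cong (λ k → linComb f′ (cv (cc (suc k)))) (sym (toℕ-fromℕ< t<n)) ⟩
    linComb f′ (cv (cc (suc (toℕ i))))        ≡⟨ cong (linComb f′) (cv-cc-suc i) ⟩
    linComb f′ (unit i)                       ≡⟨ linComb-unit f′ i ⟩
    f (suc (toℕ i))                           ≡⟨ cong (f ∘ suc) (toℕ-fromℕ< t<n) ⟩
    f (suc t)                                 ∎
    where
    i = fromℕ< t<n
    f′ = λ (i : Fin _) → f (suc (toℕ i))

  -- An identity of a Boolean group holds as soon as every variable occurs
  -- with the same parity on both sides.
  module Solver where
    module Expression = Algebra.Solver.Monoid.Expression (CommutativeMonoid.rawMonoid commutativeMonoid)
    open Expression using (Expr; var; ⟦_⟧; NormalAPI)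
    open Expression public using () renaming (_⊕_ to _⊞_; id to ∅)

    private
      normalise : ∀ {n} → Expr n → Bits n
      normalise (var i) = unit i
      normalise ∅       = 0ᵇ
      normalise (e ⊞ f) = normalise e ⊕ normalise f

      correct : ∀ {n} (e : Expr n) ρ → linComb (lookup ρ) (normalise e) ≡ ⟦ e ⟧ ρ
      correct (var i) ρ = linComb-unit (lookup ρ) i
      correct ∅       ρ = linComb-0ᵇ (lookup ρ)
      correct (e ⊞ f) ρ = trans (linComb-⊕ (lookup ρ) (normalise e) (normalise f))
                                (cong₂ _∙_ (correct e ρ) (correct f ρ))

      parityNormalForms : NormalAPI 0ℓ
      parityNormalForms = record
        { Normal    = Bits
        ; _≟_       = ≡-dec _≟_
        ; normalise = normalise
        ; ⟦_⟧⇓      = λ v ρ → linComb (lookup ρ) v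
        ; correct   = correct
        }

    open MonoidSolver monoid parityNormalForms public using (solve; _⊜_)

module _ (G G′ : BooleanGroup) where
  private
    module G  = BooleanGroup G
    module G′ = BooleanGroup G′
  open LinearCombination

  homomorphism-ε : (f : G.Carrier → G′.Carrier) → (∀ x y → f (x G.∙ y) ≡ f x G′.∙ f y) →
                   f G.ε ≡ G′.ε
  homomorphism-ε f f-∙ = begin
    f G.ε                          ≡⟨ G′.identityˡ _ ⟨
    G′.ε G′.∙ f G.ε                ≡⟨ cong (G′._∙ f G.ε) (G′.∙-self (f G.ε)) ⟨
    f G.ε G′.∙ f G.ε G′.∙ f G.ε    ≡⟨ cong (G′._∙ f G.ε) (f-∙ G.ε G.ε) ⟨
    f (G.ε G.∙ G.ε) G′.∙ f G.ε     ≡⟨ cong (λ x → f x G′.∙ f G.ε) (G.identityˡ G.ε) ⟩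
    f G.ε G′.∙ f G.ε               ≡⟨ G′.∙-self _ ⟩
    G′.ε                           ∎

  homomorphism-linComb : (f : G.Carrier → G′.Carrier) → (∀ x y → f (x G.∙ y) ≡ f x G′.∙ f y) →
                         ∀ {r} (c : Fin r → G.Carrier) v → f (linComb G c v) ≡ linComb G′ (f ∘ c) v
  homomorphism-linComb f f-∙ c []          = homomorphism-ε f f-∙
  homomorphism-linComb f f-∙ c (true ∷ v)  =
    trans (f-∙ (c 0F) _) (cong (f (c 0F) G′.∙_) (homomorphism-linComb f f-∙ (c ∘ Fin.suc) v))
  homomorphism-linComb f f-∙ c (false ∷ v) = homomorphism-linComb f f-∙ (c ∘ Fin.suc) v

module Bitwise {n : ℕ} = LinearCombination (bits-booleanGroup n)
module Parity = LinearCombination xor-booleanGroup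
open Bitwise using (linComb; linComb-cong; linComb-0ᵇ; linComb-unit; linComb-⊕; linComb-cv-cc)

linComb-false∷ : ∀ {n r} (c : Fin r → Bits n) v → linComb ((false ∷_) ∘ c) v ≡ false ∷ linComb c v
linComb-false∷ {n} c v =
  sym (homomorphism-linComb (bits-booleanGroup n) (bits-booleanGroup (suc n)) (false ∷_) (λ _ _ → refl) c v)

linComb-units : ∀ {n} (v : Bits n) → linComb unit v ≡ v
linComb-units []          = refl
linComb-units (true ∷ v)  = begin
  (true ∷ 0ᵇ) ⊕ linComb (unit ∘ Fin.suc) v   ≡⟨ cong ((true ∷ 0ᵇ) ⊕_) (linComb-false∷ unit v) ⟩
  true ∷ (0ᵇ ⊕ linComb unit v)               ≡⟨ cong (true ∷_) (trans (⊕-identityˡ _) (linComb-units v)) ⟩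
  true ∷ v                                   ∎
linComb-units (false ∷ v) = trans (linComb-false∷ unit v) (cong (false ∷_) (linComb-units v))

linComb-involutive : ∀ {n} (c : Fin n → Bits n) → (∀ i → linComb c (c i) ≡ unit i) →
                     ∀ v → linComb c (linComb c v) ≡ v
linComb-involutive {n} c c²≡unit v = begin
  linComb c (linComb c v)           ≡⟨ homomorphism-linComb G G (linComb c) (linComb-⊕ c) c v ⟩
  linComb (linComb c ∘ c) v         ≡⟨ linComb-cong c²≡unit v ⟩
  linComb unit v                    ≡⟨ linComb-units v ⟩
  v                                 ∎
  where
  G = bits-booleanGroup n

-- The group H n = D8 × (ℤ/2)^n

-- H 0 is D8 itself, and every g : H n is definitionally d8 g ⊗ cv g.
D8 : Set
D8 = H 0

d8 : ∀ {n} → H n → D8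
d8 g = ⟪ ex g , fl g , [] ⟫

infix 5 _⊗_
_⊗_ : ∀ {n} → D8 → Bits n → H n
d ⊗ v = ⟪ ex d , fl d , v ⟫

add4-identityʳ : ∀ i → add4 i 0F ≡ i
add4-identityʳ 0F = refl
add4-identityʳ 1F = refl
add4-identityʳ 2F = refl
add4-identityʳ 3F = refl

a²^ : Bool → D8
a²^ false = one
a²^ true  = gA2

module _ {n : ℕ} where

  ·-identityʳ : (g : H n) → g · one ≡ g
  ·-identityʳ ⟪ i , false , v ⟫ = cong₂ (λ k w → ⟪ k , false , w ⟫) (add4-identityʳ i) (⊕-identityʳ v)
  ·-identityʳ ⟪ i , true  , v ⟫ = cong₂ (λ k w → ⟪ k , true , w ⟫) (add4-identityʳ i) (⊕-identityʳ v)

  pow-⊗ : (g : H n) → cv g ≡ 0ᵇ → ∀ k → pow g k ≡ pow (d8 g) k ⊗ 0ᵇ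
  pow-⊗ g g∈D8 zero    = refl
  pow-⊗ g g∈D8 (suc k) = begin
    g · pow g k                         ≡⟨ cong (g ·_) (pow-⊗ g g∈D8 k) ⟩
    (d8 g · pow (d8 g) k) ⊗ cv g ⊕ 0ᵇ   ≡⟨ cong (d8 g · pow (d8 g) k ⊗_) (trans (⊕-identityʳ _) g∈D8) ⟩
    (d8 g · pow (d8 g) k) ⊗ 0ᵇ          ∎

  ⊗-· : ∀ d e (v w : Bits n) → (d ⊗ v) · (e ⊗ w) ≡ d · e ⊗ v ⊕ w
  ⊗-· d e v w = refl

  ⊗0ᵇ-· : ∀ d (g : H n) → (d ⊗ 0ᵇ) · g ≡ (d · d8 g) ⊗ cv g
  ⊗0ᵇ-· d g = cong (d · d8 g ⊗_) (⊕-identityˡ (cv g))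

  cv-gA2 : cv (gA2 {n}) ≡ 0ᵇ
  cv-gA2 = ⊕-identityˡ 0ᵇ

  central : Bool → Bits n → H n
  central s v = a²^ s ⊗ v

  central-· : ∀ s t v w → central s v · central t w ≡ central (s xor t) (v ⊕ w)
  central-· false false v w = refl
  central-· false true  v w = refl
  central-· true  false v w = refl
  central-· true  true  v w = refl

  prodC-central : ∀ {r} (f : Fin r → H n) (s : Fin r → Bool) (w : Fin r → Bits n) →
                  (∀ i → f i ≡ central (s i) (w i)) →
                  ∀ v → prodC f v ≡ central (Parity.linComb s v) (linComb w v)
  prodC-central f s w f≡central []          = refl
  prodC-central f s w f≡central (true ∷ v)  = begin
    f 0F · prodC (f ∘ Fin.suc) v
      ≡⟨ cong₂ _·_ (f≡central 0F) (prodC-central _ _ _ (f≡central ∘ Fin.suc) v) ⟩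
    central (s 0F) (w 0F) · central (Parity.linComb (s ∘ Fin.suc) v) (linComb (w ∘ Fin.suc) v)
      ≡⟨ central-· (s 0F) _ _ _ ⟩
    central (Parity.linComb s (true ∷ v)) (linComb w (true ∷ v))
      ∎
  prodC-central f s w f≡central (false ∷ v) = prodC-central _ _ _ (f≡central ∘ Fin.suc) v

  foldr-cc : (f : ℕ → ℕ) → ∀ is →
    foldr (λ i acc → cc {n} (f i) · acc) one is ≡ one ⊗ foldr (λ i acc → cv (cc {n} (f i)) ⊕ acc) 0ᵇ is
  foldr-cc f []       = refl
  foldr-cc f (i ∷ is) = cong (cc (f i) ·_) (foldr-cc f is)

double : ℕ → ℕ
double zero    = zero
double (suc k) = suc (suc (double k))

double≡2* : ∀ k → double k ≡ 2 * k
double≡2* zero    = refl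
double≡2* (suc k) = cong suc (trans (cong suc (double≡2* k)) (sym (+-suc k (k + 0))))

suc-suc-/2 : ∀ k → suc (suc k) / 2 ≡ suc (k / 2)
suc-suc-/2 k = m/n≡1+[m∸n]/n {suc (suc k)} (s≤s (s≤s z≤n))

double-/2 : ∀ k → double k / 2 ≡ k
double-/2 zero    = refl
double-/2 (suc k) = trans (suc-suc-/2 (double k)) (cong suc (double-/2 k))

suc-double-/2 : ∀ k → suc (double k) / 2 ≡ k
suc-double-/2 zero    = refl
suc-double-/2 (suc k) = trans (suc-suc-/2 (suc (double k))) (cong suc (suc-double-/2 k))

double-%2 : ∀ k → double k % 2 ≡ 0
double-%2 zero    = refl
double-%2 (suc k) = double-%2 k

suc-double-%2 : ∀ k → suc (double k) % 2 ≡ 1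
suc-double-%2 zero    = refl
suc-double-%2 (suc k) = suc-double-%2 k

double-≡ᵇ : ∀ {j k} → j < k → (double j ≡ᵇ double k) ≡ false
double-≡ᵇ {zero}  {suc k} _         = refl
double-≡ᵇ {suc j} {suc k} (s≤s j<k) = double-≡ᵇ j<k

suc-double-≡ᵇ : ∀ j k → (suc (double j) ≡ᵇ double k) ≡ false
suc-double-≡ᵇ j       zero    = refl
suc-double-≡ᵇ zero    (suc k) = refl
suc-double-≡ᵇ (suc j) (suc k) = suc-double-≡ᵇ j k

≡ᵇ-refl : ∀ k → (k ≡ᵇ k) ≡ true
≡ᵇ-refl zero    = refl
≡ᵇ-refl (suc k) = ≡ᵇ-refl k

double-mono-≤ : ∀ {j k} → j ≤ k → double j ≤ double k
double-mono-≤ z≤n       = z≤n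
double-mono-≤ (s≤s j≤k) = s≤s (s≤s (double-mono-≤ j≤k))

double-<-mono : ∀ {j k} → j < k → suc (double j) < suc (double k)
double-<-mono {zero}  {suc k} _         = s≤s (s≤s z≤n)
double-<-mono {suc j} {suc k} (s≤s j<k) = s≤s (s≤s (double-<-mono j<k))

data Position (p : ℕ) : ℕ → Set where
  odd  : ∀ {j} → j < p → Position p (suc (double j))
  even : ∀ {j} → j < p → Position p (suc (suc (double j)))
  last : Position p (suc (double p))

position-suc : ∀ {p k} → Position p k → Position (suc p) (suc (suc k))
position-suc (odd j<p)  = odd (s≤s j<p)
position-suc (even j<p) = even (s≤s j<p)
position-suc last       = last

position : ∀ p t → t < suc (double p) → Position p (suc t)
position zero    zero          _                = last
position zero    (suc t)       (s≤s ())
position (suc p) zero          _                = odd (s≤s z≤n)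
position (suc p) (suc zero)    _                = even (s≤s z≤n)
position (suc p) (suc (suc t)) (s≤s (s≤s t<N)) = position-suc (position p t t<N)

-- The D8-parts of x, y and z

x̄ : Bool → D8 → D8
x̄ s d = pow (inv gA) (toℕ (ex d)) · (pow (gA · gB) (b2n (fl d)) · a²^ s)

τ̄ : D8 → D8
τ̄ d = pow gB (toℕ (ex d) / 2) · (pow gA2 (b2n (fl d)) · one)

ȳ : D8 → D8
ȳ d = if inK d then τ̄ d else gA · τ̄ (inv gA · d)

z̄ : D8 → D8
z̄ d = ȳ (d · gA) · inv gA

inK-ȳ : (d : D8) → inK (ȳ d) ≡ inK d
inK-ȳ ⟪ 0F , false , [] ⟫ = refl
inK-ȳ ⟪ 0F , true  , [] ⟫ = refl
inK-ȳ ⟪ 1F , false , [] ⟫ = refl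
inK-ȳ ⟪ 1F , true  , [] ⟫ = refl
inK-ȳ ⟪ 2F , false , [] ⟫ = refl
inK-ȳ ⟪ 2F , true  , [] ⟫ = refl
inK-ȳ ⟪ 3F , false , [] ⟫ = refl
inK-ȳ ⟪ 3F , true  , [] ⟫ = refl

inK-·gA : (d : D8) → inK (d · gA) ≡ not (inK d)
inK-·gA ⟪ 0F , false , [] ⟫ = refl
inK-·gA ⟪ 0F , true  , [] ⟫ = refl
inK-·gA ⟪ 1F , false , [] ⟫ = refl
inK-·gA ⟪ 1F , true  , [] ⟫ = refl
inK-·gA ⟪ 2F , false , [] ⟫ = refl
inK-·gA ⟪ 2F , true  , [] ⟫ = refl
inK-·gA ⟪ 3F , false , [] ⟫ = refl
inK-·gA ⟪ 3F , true  , [] ⟫ = refl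

data Move : Set where
  yz xyzx : Move

move : Bool → Move → D8 → D8
move s yz   d = z̄ (ȳ d)
move s xyzx d = x̄ s (z̄ (ȳ (x̄ s d)))

run : Bool → List Move → D8 → D8
run s []      d = d
run s (μ ∷ w) d = run s w (move s μ d)

-- Found by breadth-first search: yz and xyzx act transitively on D8 ∖ {1}.
route-to-a : ∀ s d → d ≢ one → Σ (List Move) (λ w → run s w d ≡ gA)
route-to-a s     ⟪ 0F , false , [] ⟫ d≢1 = ⊥-elim (d≢1 refl)
route-to-a false ⟪ 0F , true  , [] ⟫ _ = xyzx ∷ [] , refl
route-to-a false ⟪ 1F , false , [] ⟫ _ = [] , refl
route-to-a false ⟪ 1F , true  , [] ⟫ _ = yz ∷ yz ∷ [] , refl
route-to-a false ⟪ 2F , false , [] ⟫ _ = yz ∷ xyzx ∷ [] , refl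
route-to-a false ⟪ 2F , true  , [] ⟫ _ = yz ∷ yz ∷ xyzx ∷ [] , refl
route-to-a false ⟪ 3F , false , [] ⟫ _ = yz ∷ [] , refl
route-to-a false ⟪ 3F , true  , [] ⟫ _ = xyzx ∷ yz ∷ xyzx ∷ [] , refl
route-to-a true  ⟪ 0F , true  , [] ⟫ _ = yz ∷ xyzx ∷ yz ∷ [] , refl
route-to-a true  ⟪ 1F , false , [] ⟫ _ = [] , refl
route-to-a true  ⟪ 1F , true  , [] ⟫ _ = yz ∷ yz ∷ [] , refl
route-to-a true  ⟪ 2F , false , [] ⟫ _ = yz ∷ yz ∷ xyzx ∷ yz ∷ [] , refl
route-to-a true  ⟪ 2F , true  , [] ⟫ _ = xyzx ∷ yz ∷ [] , refl
route-to-a true  ⟪ 3F , false , [] ⟫ _ = yz ∷ [] , refl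
route-to-a true  ⟪ 3F , true  , [] ⟫ _ = xyzx ∷ yz ∷ yz ∷ [] , refl

route-a-to-b : ∀ s → Σ (List Move) (λ w → run s w gA ≡ gB)
route-a-to-b false = xyzx ∷ xyzx ∷ [] , refl
route-a-to-b true  = xyzx ∷ yz ∷ yz ∷ [] , refl

-- The case m = 2p + 4

module Case (p : ℕ) where

  m N : ℕ
  m = suc (suc (suc (suc (double p))))
  N = suc (double p)

  ĉ : ℕ → Bits N
  ĉ k = cv (cc {N} k)

  -- o j = c_{2j+1}, e j = c_{2j+2}, and prev j = c_{2j-1} c_{2j}, which is 0ᵇ for j = 0
  -- because 2 · 0 ∸ 1 = 0 and c_0 = 1.
  o e prev : ℕ → Bits N
  o j    = ĉ (suc (double j))
  e j    = ĉ (suc (suc (double j)))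
  prev j = ĉ (double j ∸ 1) ⊕ ĉ (double j)

  xa-gen : ℕ → Bool
  xa-gen k = if k ≡ᵇ N then true else if k % 2 ≡ᵇ 1 then false else true

  xC-central : ∀ k → xC m k ≡ central (xa-gen k) (cv (xC m k))
  xC-central k with k ≡ᵇ N | k % 2 ≡ᵇ 1
  ... | true  | _     = refl
  ... | false | true  = refl
  ... | false | false = refl

  τC-central : ∀ k → τC m k ≡ central false (cv (τC m k))
  τC-central k with k ≡ᵇ N | k % 2 ≡ᵇ 1
  ... | true  | _     = refl
  ... | false | true  = refl
  ... | false | false = refl

  xC-odd : ∀ {j} → j < p → xC m (suc (double j)) ≡ central false (o j)
  xC-odd {j} j<p rewrite double-≡ᵇ j<p | suc-double-%2 j = refl

  τC-odd : ∀ {j} → j < p → τC m (suc (double j)) ≡ central false (prev j ⊕ e j)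
  τC-odd {j} j<p
    rewrite double-≡ᵇ j<p | suc-double-%2 j | suc-double-/2 j | sym (double≡2* j) | +-comm (double j) 2 = refl

  xC-even : ∀ j → xC m (suc (suc (double j))) ≡ central true (o j ⊕ e j)
  xC-even j rewrite suc-double-≡ᵇ j p | double-%2 j =
    cong (λ w → central true (w ⊕ e j)) (trans (cong (_⊕ o j) cv-gA2) (⊕-identityˡ (o j)))

  xC-last : xC m N ≡ central true (o p)
  xC-last rewrite ≡ᵇ-refl (double p) = cong (central true) (trans (cong (_⊕ o p) cv-gA2) (⊕-identityˡ (o p)))

  τC-even : ∀ j → τC m (suc (suc (double j))) ≡ central false (prev j ⊕ o j)
  τC-even j rewrite suc-double-≡ᵇ j p | double-%2 j | double-/2 j | sym (double≡2* j) | +-comm (double j) 1 = refl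

  τC-last : τC m N ≡ central false (o p)
  τC-last rewrite ≡ᵇ-refl (double p) = refl

  xa-gen-odd : ∀ {j} → j < p → xa-gen (suc (double j)) ≡ false
  xa-gen-odd {j} j<p rewrite double-≡ᵇ j<p | suc-double-%2 j = refl

  xa-gen-even : ∀ j → xa-gen (suc (suc (double j))) ≡ true
  xa-gen-even j rewrite suc-double-≡ᵇ j p | double-%2 j = refl

  xColumn τColumn : Fin N → Bits N
  xColumn i = cv (xC m (suc (toℕ i)))
  τColumn i = cv (τC m (suc (toℕ i)))

  xc τc : Bits N → Bits N
  xc = linComb xColumn
  τc = linComb τColumn

  xc-⊕ : ∀ v w → xc (v ⊕ w) ≡ xc v ⊕ xc w
  xc-⊕ = linComb-⊕ xColumn

  τc-⊕ : ∀ v w → τc (v ⊕ w) ≡ τc v ⊕ τc w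
  τc-⊕ = linComb-⊕ τColumn

  xa : Bits N → Bool
  xa = Parity.linComb (λ i → xa-gen (suc (toℕ i)))

  xa-⊕ : ∀ v w → xa (v ⊕ w) ≡ xa v xor xa w
  xa-⊕ = Parity.linComb-⊕ _

  o-bound : ∀ {j} → j ≤ p → double j < N
  o-bound j≤p = s≤s (double-mono-≤ j≤p)

  xc-o : ∀ {j} → j < p → xc (o j) ≡ o j
  xc-o {j} j<p = trans (linComb-cv-cc (cv ∘ xC m) (double j) (o-bound (<⇒≤ j<p))) (cong cv (xC-odd j<p))

  xc-e : ∀ {j} → j < p → xc (e j) ≡ o j ⊕ e j
  xc-e {j} j<p = trans (linComb-cv-cc (cv ∘ xC m) (suc (double j)) (double-<-mono j<p)) (cong cv (xC-even j))

  xc-last : xc (o p) ≡ o p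
  xc-last = trans (linComb-cv-cc (cv ∘ xC m) (double p) (o-bound ≤-refl)) (cong cv xC-last)

  τc-o : ∀ {j} → j < p → τc (o j) ≡ prev j ⊕ e j
  τc-o {j} j<p = trans (linComb-cv-cc (cv ∘ τC m) (double j) (o-bound (<⇒≤ j<p))) (cong cv (τC-odd j<p))

  τc-e : ∀ {j} → j < p → τc (e j) ≡ prev j ⊕ o j
  τc-e {j} j<p = trans (linComb-cv-cc (cv ∘ τC m) (suc (double j)) (double-<-mono j<p)) (cong cv (τC-even j))

  τc-last : τc (o p) ≡ o p
  τc-last = trans (linComb-cv-cc (cv ∘ τC m) (double p) (o-bound ≤-refl)) (cong cv τC-last)

  xa-o : ∀ {j} → j < p → xa (o j) ≡ false
  xa-o {j} j<p = trans (Parity.linComb-cv-cc xa-gen (double j) (o-bound (<⇒≤ j<p))) (xa-gen-odd j<p)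

  xa-e : ∀ {j} → j < p → xa (e j) ≡ true
  xa-e {j} j<p = trans (Parity.linComb-cv-cc xa-gen (suc (double j)) (double-<-mono j<p)) (xa-gen-even j)

  on-basis : {P : ℕ → Set} → (∀ {j} → j < p → P (suc (double j))) →
             (∀ {j} → j < p → P (suc (suc (double j)))) → P N → ∀ t → t < N → P (suc t)
  on-basis P-o P-e P-last t t<N with position p t t<N
  ... | odd j<p  = P-o j<p
  ... | even j<p = P-e j<p
  ... | last     = P-last

  open Bitwise.Solver

  xc-involutive : ∀ v → xc (xc v) ≡ v
  xc-involutive = linComb-involutive _ λ i →
    trans (on-basis {λ k → xc (cv (xC m k)) ≡ ĉ k} odd-case even-case last-case (toℕ i) (toℕ<n i)) (cv-cc-suc i)
    where
    odd-case : ∀ {j} → j < p → xc (cv (xC m (suc (double j)))) ≡ o j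
    odd-case j<p = trans (cong (xc ∘ cv) (xC-odd j<p)) (xc-o j<p)

    even-case : ∀ {j} → j < p → xc (cv (xC m (suc (suc (double j))))) ≡ e j
    even-case {j} j<p = begin
      xc (cv (xC m (suc (suc (double j)))))  ≡⟨ cong (xc ∘ cv) (xC-even j) ⟩
      xc (o j ⊕ e j)                         ≡⟨ xc-⊕ (o j) (e j) ⟩
      xc (o j) ⊕ xc (e j)                    ≡⟨ cong₂ _⊕_ (xc-o j<p) (xc-e j<p) ⟩
      o j ⊕ (o j ⊕ e j)                      ≡⟨ solve 2 (λ a b → a ⊞ (a ⊞ b) ⊜ b) refl (o j) (e j) ⟩
      e j                                    ∎

    last-case : xc (cv (xC m N)) ≡ o p
    last-case = trans (cong (xc ∘ cv) xC-last) xc-last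

  τc-prev : ∀ {j} → j < p → τc (prev j) ≡ prev j
  τc-prev {zero}  _     = begin
    τc (ĉ 0 ⊕ ĉ 0)   ≡⟨ cong τc (⊕-self (ĉ 0)) ⟩
    τc 0ᵇ            ≡⟨ linComb-0ᵇ τColumn ⟩
    0ᵇ               ≡⟨ ⊕-self (ĉ 0) ⟨
    ĉ 0 ⊕ ĉ 0        ∎
  τc-prev {suc j} j+1<p = begin
    τc (o j ⊕ e j)                          ≡⟨ τc-⊕ (o j) (e j) ⟩
    τc (o j) ⊕ τc (e j)                     ≡⟨ cong₂ _⊕_ (τc-o j<p) (τc-e j<p) ⟩
    (prev j ⊕ e j) ⊕ (prev j ⊕ o j)         ≡⟨ solve 3 (λ a b c → (a ⊞ c) ⊞ (a ⊞ b) ⊜ b ⊞ c) refl (prev j) (o j) (e j) ⟩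
    o j ⊕ e j                               ∎
    where j<p = <-trans (n<1+n j) j+1<p

  τc-involutive : ∀ v → τc (τc v) ≡ v
  τc-involutive = linComb-involutive _ λ i →
    trans (on-basis {λ k → τc (cv (τC m k)) ≡ ĉ k} odd-case even-case last-case (toℕ i) (toℕ<n i)) (cv-cc-suc i)
    where
    odd-case : ∀ {j} → j < p → τc (cv (τC m (suc (double j)))) ≡ o j
    odd-case {j} j<p = begin
      τc (cv (τC m (suc (double j))))   ≡⟨ cong (τc ∘ cv) (τC-odd j<p) ⟩
      τc (prev j ⊕ e j)                 ≡⟨ τc-⊕ (prev j) (e j) ⟩
      τc (prev j) ⊕ τc (e j)            ≡⟨ cong₂ _⊕_ (τc-prev j<p) (τc-e j<p) ⟩
      prev j ⊕ (prev j ⊕ o j)           ≡⟨ solve 2 (λ a b → a ⊞ (a ⊞ b) ⊜ b) refl (prev j) (o j) ⟩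
      o j                               ∎

    even-case : ∀ {j} → j < p → τc (cv (τC m (suc (suc (double j))))) ≡ e j
    even-case {j} j<p = begin
      τc (cv (τC m (suc (suc (double j)))))  ≡⟨ cong (τc ∘ cv) (τC-even j) ⟩
      τc (prev j ⊕ o j)                      ≡⟨ τc-⊕ (prev j) (o j) ⟩
      τc (prev j) ⊕ τc (o j)                 ≡⟨ cong₂ _⊕_ (τc-prev j<p) (τc-o j<p) ⟩
      prev j ⊕ (prev j ⊕ e j)                ≡⟨ solve 2 (λ a b → a ⊞ (a ⊞ b) ⊜ b) refl (prev j) (e j) ⟩
      e j                                    ∎

    last-case : τc (cv (τC m N)) ≡ o p
    last-case = trans (cong (τc ∘ cv) τC-last) τc-last

  xa-xc : ∀ v → xa (xc v) ≡ xa v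
  xa-xc v = trans
    (homomorphism-linComb (bits-booleanGroup N) xor-booleanGroup xa xa-⊕ xColumn v)
    (Parity.linComb-cong (λ i → on-basis {λ k → xa (cv (xC m k)) ≡ xa-gen k} odd-case even-case last-case
                                                  (toℕ i) (toℕ<n i)) v)
    where
    odd-case : ∀ {j} → j < p → xa (cv (xC m (suc (double j)))) ≡ xa-gen (suc (double j))
    odd-case {j} j<p = trans (cong (xa ∘ cv) (xC-odd j<p)) (trans (xa-o j<p) (sym (xa-gen-odd j<p)))

    even-case : ∀ {j} → j < p → xa (cv (xC m (suc (suc (double j))))) ≡ xa-gen (suc (suc (double j)))
    even-case {j} j<p = begin
      xa (cv (xC m (suc (suc (double j)))))  ≡⟨ cong (xa ∘ cv) (xC-even j) ⟩
      xa (o j ⊕ e j)                         ≡⟨ xa-⊕ (o j) (e j) ⟩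
      xa (o j) xor xa (e j)                  ≡⟨ cong₂ _xor_ (xa-o j<p) (xa-e j<p) ⟩
      true                                   ≡⟨ xa-gen-even j ⟨
      xa-gen (suc (suc (double j)))          ∎

    last-case : xa (cv (xC m N)) ≡ xa-gen N
    last-case = trans (cong (xa ∘ cv) xC-last) (Parity.linComb-cv-cc xa-gen (double p) (o-bound ≤-refl))

  oSum : ℕ → Bits N
  oSum zero    = 0ᵇ
  oSum (suc q) = oSum q ⊕ o q

  u : Bits N
  u = oSum (suc p)

  hh≡ : hh m ≡ gA ⊗ u
  hh≡ = begin
    gA · foldr (λ i acc → cc (2 * i + 1) · acc) one (upTo (double p / 2 + 1))
      ≡⟨ cong (gA ·_) (foldr-cc (λ i → 2 * i + 1) (upTo (double p / 2 + 1))) ⟩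
    gA ⊗ 0ᵇ ⊕ oddSum (upTo (double p / 2 + 1))
      ≡⟨ cong (gA ⊗_) (⊕-identityˡ _) ⟩
    gA ⊗ oddSum (upTo (double p / 2 + 1))
      ≡⟨ cong (λ k → gA ⊗ oddSum (upTo k)) (trans (cong (_+ 1) (double-/2 p)) (+-comm p 1)) ⟩
    gA ⊗ oddSum (upTo (suc p))
      ≡⟨ cong (gA ⊗_) (oddSum-upTo (suc p)) ⟩
    gA ⊗ u
      ∎
    where
    oddSum : List ℕ → Bits N
    oddSum = foldr (λ i acc → ĉ (2 * i + 1) ⊕ acc) 0ᵇ
    oddSum-upTo : ∀ q → oddSum (upTo q) ≡ oSum q
    oddSum-upTo zero    = refl
    oddSum-upTo (suc q) = begin
      oddSum (upTo (suc q))
        ≡⟨ foldr-⊕-applyUpTo-suc (λ i → ĉ (2 * i + 1)) (λ i → i) q ⟩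
      oddSum (upTo q) ⊕ ĉ (2 * q + 1)
        ≡⟨ cong₂ _⊕_ (oddSum-upTo q) (cong ĉ (trans (+-comm (2 * q) 1) (cong suc (sym (double≡2* q))))) ⟩
      oSum q ⊕ o q
        ∎

  δ : Bits N
  δ = u ⊕ τc u ⊕ o p

  τc-oSum : ∀ {q} → q < p → τc (oSum (suc q)) ≡ oSum q ⊕ e q
  τc-oSum {zero} 0<p = begin
    τc (0ᵇ ⊕ o 0)    ≡⟨ cong τc (⊕-identityˡ (o 0)) ⟩
    τc (o 0)         ≡⟨ τc-o 0<p ⟩
    prev 0 ⊕ e 0     ≡⟨ cong (_⊕ e 0) (⊕-self (ĉ 0)) ⟩
    0ᵇ ⊕ e 0         ∎
  τc-oSum {suc q} q+1<p = begin
    τc (oSum (suc q) ⊕ o (suc q))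
      ≡⟨ τc-⊕ (oSum (suc q)) (o (suc q)) ⟩
    τc (oSum (suc q)) ⊕ τc (o (suc q))
      ≡⟨ cong₂ _⊕_ (τc-oSum (<-trans (n<1+n q) q+1<p)) (τc-o q+1<p) ⟩
    (oSum q ⊕ e q) ⊕ ((o q ⊕ e q) ⊕ e (suc q))
      ≡⟨ solve 4 (λ s a b c → (s ⊞ b) ⊞ ((a ⊞ b) ⊞ c) ⊜ (s ⊞ a) ⊞ c) refl _ _ _ _ ⟩
    (oSum q ⊕ o q) ⊕ e (suc q)
      ∎

  δ≡ : δ ≡ oSum p ⊕ τc (oSum p) ⊕ o p
  δ≡ = begin
    (oSum p ⊕ o p) ⊕ τc (oSum p ⊕ o p) ⊕ o p
      ≡⟨ cong (λ w → (oSum p ⊕ o p) ⊕ w ⊕ o p) (trans (τc-⊕ (oSum p) (o p)) (cong (τc (oSum p) ⊕_) τc-last)) ⟩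
    (oSum p ⊕ o p) ⊕ (τc (oSum p) ⊕ o p) ⊕ o p
      ≡⟨ solve 3 (λ s t c → ((s ⊞ c) ⊞ (t ⊞ c)) ⊞ c ⊜ (s ⊞ t) ⊞ c) refl _ _ _ ⟩
    oSum p ⊕ τc (oSum p) ⊕ o p
      ∎

  δ≡o⊕e⊕last : ∀ {q} → suc q ≡ p → δ ≡ o q ⊕ e q ⊕ o p
  δ≡o⊕e⊕last {q} refl = begin
    δ
      ≡⟨ δ≡ ⟩
    (oSum q ⊕ o q) ⊕ τc (oSum (suc q)) ⊕ o p
      ≡⟨ cong (λ t → (oSum q ⊕ o q) ⊕ t ⊕ o p) (τc-oSum (n<1+n q)) ⟩
    (oSum q ⊕ o q) ⊕ (oSum q ⊕ e q) ⊕ o p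
      ≡⟨ solve 4 (λ s a b c → ((s ⊞ a) ⊞ (s ⊞ b)) ⊞ c ⊜ (a ⊞ b) ⊞ c) refl _ _ _ _ ⟩
    o q ⊕ e q ⊕ o p
      ∎

  τc-δ : τc δ ≡ δ
  τc-δ = begin
    τc (u ⊕ τc u ⊕ o p)                ≡⟨ τc-⊕ (u ⊕ τc u) (o p) ⟩
    τc (u ⊕ τc u) ⊕ τc (o p)           ≡⟨ cong₂ _⊕_ (τc-⊕ u (τc u)) τc-last ⟩
    τc u ⊕ τc (τc u) ⊕ o p             ≡⟨ cong (λ w → τc u ⊕ w ⊕ o p) (τc-involutive u) ⟩
    τc u ⊕ u ⊕ o p                     ≡⟨ cong (_⊕ o p) (⊕-comm (τc u) u) ⟩
    δ                                  ∎

  x-action : ∀ d v → xAut m (d ⊗ v) ≡ x̄ (xa v) d ⊗ xc v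
  x-action d v = begin
    pow (inv gA) i · (pow (gA · gB) j · prodC (λ k → xC m (suc (toℕ k))) v)
      ≡⟨ cong (λ c → pow (inv gA) i · (pow (gA · gB) j · c)) (prodC-central _ _ xColumn (xC-central ∘ suc ∘ toℕ) v) ⟩
    pow (inv gA) i · (pow (gA · gB) j · central (xa v) (xc v))
      ≡⟨ cong₂ (λ a b → a · (b · central (xa v) (xc v)))
               (pow-⊗ (inv gA) refl i) (pow-⊗ (gA · gB) (⊕-identityˡ 0ᵇ) j) ⟩
    (pow (inv gA) i ⊗ 0ᵇ) · ((pow (gA · gB) j ⊗ 0ᵇ) · central (xa v) (xc v))
      ≡⟨ cong ((pow (inv gA) i ⊗ 0ᵇ) ·_) (⊗0ᵇ-· (pow (gA · gB) j) (central (xa v) (xc v))) ⟩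
    (pow (inv gA) i ⊗ 0ᵇ) · (pow (gA · gB) j · a²^ (xa v) ⊗ xc v)
      ≡⟨ ⊗0ᵇ-· (pow (inv gA) i) (pow (gA · gB) j · a²^ (xa v) ⊗ xc v) ⟩
    x̄ (xa v) d ⊗ xc v
      ∎
    where
    i = toℕ (ex d)
    j = b2n (fl d)

  τK-action : ∀ d v → τK m (d ⊗ v) ≡ τ̄ d ⊗ τc v
  τK-action d v = begin
    pow gB i · (pow gA2 j · prodC (λ k → τC m (suc (toℕ k))) v)
      ≡⟨ cong (λ c → pow gB i · (pow gA2 j · c))
              (prodC-central _ (λ _ → false) τColumn (τC-central ∘ suc ∘ toℕ) v) ⟩
    pow gB i · (pow gA2 j · central (Parity.linComb (λ _ → false) v) (τc v))
      ≡⟨ cong (λ s → pow gB i · (pow gA2 j · central s (τc v))) (Parity.linComb-ε v) ⟩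
    pow gB i · (pow gA2 j · (one ⊗ τc v))
      ≡⟨ cong₂ (λ a b → a · (b · (one ⊗ τc v))) (pow-⊗ gB refl i) (pow-⊗ gA2 cv-gA2 j) ⟩
    (pow gB i ⊗ 0ᵇ) · ((pow gA2 j ⊗ 0ᵇ) · (one ⊗ τc v))
      ≡⟨ cong ((pow gB i ⊗ 0ᵇ) ·_) (⊗0ᵇ-· (pow gA2 j) (one ⊗ τc v)) ⟩
    (pow gB i ⊗ 0ᵇ) · (pow gA2 j · one ⊗ τc v)
      ≡⟨ ⊗0ᵇ-· (pow gB i) (pow gA2 j · one ⊗ τc v) ⟩
    τ̄ d ⊗ τc v
      ∎
    where
    i = toℕ (ex d) / 2
    j = b2n (fl d)

  shift : Bool → Bits N
  shift true  = 0ᵇ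
  shift false = δ

  y-action : ∀ d v → yPerm m (d ⊗ v) ≡ ȳ d ⊗ τc v ⊕ shift (inK d)
  y-action d v = by-parity (inK d) refl
    where
    by-parity : ∀ b → inK d ≡ b →
                yPerm m (d ⊗ v) ≡ (if b then τ̄ d else gA · τ̄ (inv gA · d)) ⊗ τc v ⊕ shift b
    by-parity true  d∈K = begin
      yPerm m (d ⊗ v)     ≡⟨ if-cong d∈K ⟩
      τK m (d ⊗ v)        ≡⟨ τK-action d v ⟩
      τ̄ d ⊗ τc v          ≡⟨ cong (τ̄ d ⊗_) (⊕-identityʳ (τc v)) ⟨
      τ̄ d ⊗ τc v ⊕ 0ᵇ     ∎
    by-parity false d∉K = begin
      yPerm m (d ⊗ v)
        ≡⟨ if-cong d∉K ⟩
      (hh m · τK m (inv (hh m) · (d ⊗ v))) · cc N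
        ≡⟨ cong (λ h → (h · τK m (inv h · (d ⊗ v))) · cc N) hh≡ ⟩
      ((gA ⊗ u) · τK m (inv gA · d ⊗ u ⊕ v)) · cc N
        ≡⟨ cong (λ g → ((gA ⊗ u) · g) · cc N) (τK-action (inv gA · d) (u ⊕ v)) ⟩
      ((gA · τ̄ (inv gA · d)) · one) ⊗ u ⊕ τc (u ⊕ v) ⊕ o p
        ≡⟨ cong₂ _⊗_ (·-identityʳ (gA · τ̄ (inv gA · d))) (cong (λ w → u ⊕ w ⊕ o p) (τc-⊕ u v)) ⟩
      (gA · τ̄ (inv gA · d)) ⊗ u ⊕ (τc u ⊕ τc v) ⊕ o p
        ≡⟨ cong (gA · τ̄ (inv gA · d) ⊗_)
             (solve 4 (λ a b c k → (a ⊞ (b ⊞ c)) ⊞ k ⊜ c ⊞ ((a ⊞ b) ⊞ k)) refl u (τc u) (τc v) (o p)) ⟩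
      (gA · τ̄ (inv gA · d)) ⊗ τc v ⊕ δ
        ∎

  z-action : ∀ d v → zPerm m (d ⊗ v) ≡ z̄ d ⊗ τc v ⊕ shift (inK d)
  z-action d v = begin
    yPerm m ((d ⊗ v) · hh m) · (inv (hh m) · cc N)
      ≡⟨ cong (λ h → yPerm m ((d ⊗ v) · h) · (inv h · cc N)) hh≡ ⟩
    yPerm m ((d ⊗ v) · (gA ⊗ u)) · (inv gA ⊗ u ⊕ o p)
      ≡⟨ cong (λ g → yPerm m g · (inv gA ⊗ u ⊕ o p)) (⊗-· d gA v u) ⟩
    yPerm m (d · gA ⊗ v ⊕ u) · (inv gA ⊗ u ⊕ o p)
      ≡⟨ cong (_· (inv gA ⊗ u ⊕ o p)) (y-action (d · gA) (v ⊕ u)) ⟩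
    (ȳ (d · gA) ⊗ τc (v ⊕ u) ⊕ shift (inK (d · gA))) · (inv gA ⊗ u ⊕ o p)
      ≡⟨ ⊗-· (ȳ (d · gA)) (inv gA) _ _ ⟩
    z̄ d ⊗ τc (v ⊕ u) ⊕ shift (inK (d · gA)) ⊕ (u ⊕ o p)
      ≡⟨ cong (λ b → z̄ d ⊗ τc (v ⊕ u) ⊕ shift b ⊕ (u ⊕ o p)) (inK-·gA d) ⟩
    z̄ d ⊗ τc (v ⊕ u) ⊕ shift (not (inK d)) ⊕ (u ⊕ o p)
      ≡⟨ cong (λ w → z̄ d ⊗ w ⊕ shift (not (inK d)) ⊕ (u ⊕ o p)) (τc-⊕ v u) ⟩
    z̄ d ⊗ (τc v ⊕ τc u) ⊕ shift (not (inK d)) ⊕ (u ⊕ o p)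
      ≡⟨ cong (z̄ d ⊗_) (shift-not (inK d)) ⟩
    z̄ d ⊗ τc v ⊕ shift (inK d)
      ∎
    where
    shift-not : ∀ b → (τc v ⊕ τc u) ⊕ shift (not b) ⊕ (u ⊕ o p) ≡ τc v ⊕ shift b
    shift-not true  = solve 4 (λ a b c k → ((a ⊞ b) ⊞ ((c ⊞ b) ⊞ k)) ⊞ (c ⊞ k) ⊜ a ⊞ ∅) refl _ _ _ _
    shift-not false = solve 4 (λ a b c k → ((a ⊞ b) ⊞ ∅) ⊞ (c ⊞ k) ⊜ a ⊞ ((c ⊞ b) ⊞ k)) refl _ _ _ _

  τc-shift : ∀ b → τc (shift b) ≡ shift b
  τc-shift true  = linComb-0ᵇ τColumn
  τc-shift false = τc-δ

  Reach : HH m → HH m → Set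
  Reach g g′ = Σ (HH m → HH m) (λ ζ → InXYZ m ζ × ζ g ≡ g′)

  infixr 4 _⨾_
  _⨾_ : ∀ {g g′ g″} → Reach g g′ → Reach g′ g″ → Reach g g″
  (ζ , ζ∈ , ζg≡) ⨾ (η , η∈ , ηg≡) = (λ g → η (ζ g)) , gen-comp ζ∈ η∈ , trans (cong η ζg≡) ηg≡

  reach-≡ : ∀ {g g′ g″} → Reach g g′ → g′ ≡ g″ → Reach g g″
  reach-≡ (ζ , ζ∈ , ζg≡) g′≡g″ = ζ , ζ∈ , trans ζg≡ g′≡g″

  reach-x : ∀ d v → Reach (d ⊗ v) (x̄ (xa v) d ⊗ xc v)
  reach-x d v = xAut m , gen-x , x-action d v

  reach-y : ∀ d v → Reach (d ⊗ v) (ȳ d ⊗ τc v ⊕ shift (inK d))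
  reach-y d v = yPerm m , gen-y , y-action d v

  reach-z : ∀ d v → Reach (d ⊗ v) (z̄ d ⊗ τc v ⊕ shift (inK d))
  reach-z d v = zPerm m , gen-z , z-action d v

  reach-move : ∀ μ d v → Reach (d ⊗ v) (move (xa v) μ d ⊗ v)
  reach-move yz d v =
    reach-≡ (reach-y d v ⨾ reach-z (ȳ d) (τc v ⊕ shift (inK d))) (cong (z̄ (ȳ d) ⊗_) c-part)
    where
    s = shift (inK d)
    c-part : τc (τc v ⊕ s) ⊕ shift (inK (ȳ d)) ≡ v
    c-part = begin
      τc (τc v ⊕ s) ⊕ shift (inK (ȳ d))    ≡⟨ cong₂ (λ w b → w ⊕ shift b) (τc-⊕ (τc v) s) (inK-ȳ d) ⟩
      τc (τc v) ⊕ τc s ⊕ s                ≡⟨ cong₂ (λ w w′ → w ⊕ w′ ⊕ s) (τc-involutive v) (τc-shift (inK d)) ⟩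
      v ⊕ s ⊕ s                           ≡⟨ solve 2 (λ a b → (a ⊞ b) ⊞ b ⊜ a) refl v s ⟩
      v                                   ∎
  reach-move xyzx d v =
    reach-x d v ⨾ reach-move yz (x̄ (xa v) d) (xc v) ⨾
    reach-≡ (reach-x d′ (xc v)) (cong₂ (λ s w → x̄ s d′ ⊗ w) (xa-xc v) (xc-involutive v))
    where d′ = z̄ (ȳ (x̄ (xa v) d))

  reach-run : ∀ w d v → Reach (d ⊗ v) (run (xa v) w d ⊗ v)
  reach-run []      d v = (λ g → g) , gen-id , refl
  reach-run (μ ∷ w) d v = reach-move μ d v ⨾ reach-run w (move (xa v) μ d) v

  reach-a : ∀ d v → d ≢ one → Reach (d ⊗ v) (gA ⊗ v)
  reach-a d v d≢1 with route-to-a (xa v) d d≢1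
  ... | w , w-d≡a = reach-≡ (reach-run w d v) (cong (_⊗ v) w-d≡a)

  reach-a-b : ∀ v → Reach (gA ⊗ v) (gB ⊗ v)
  reach-a-b v with route-a-to-b (xa v)
  ... | w , w-a≡b = reach-≡ (reach-run w gA v) (cong (_⊗ v) w-a≡b)

  infix 4 _⇝_
  _⇝_ : Bits N → Bits N → Set
  v ⇝ w = ∀ d → d ≢ one → Reach (d ⊗ v) (gA ⊗ w)

  ⇝-trans : ∀ {u v w} → u ⇝ v → v ⇝ w → u ⇝ w
  ⇝-trans u⇝v v⇝w d d≢1 = u⇝v d d≢1 ⨾ v⇝w gA (λ ())

  ⇝-≡ : ∀ {v w w′} → v ⇝ w → w ≡ w′ → v ⇝ w′
  ⇝-≡ v⇝w refl = v⇝w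

  ⇝-xc : ∀ v → v ⇝ xc v
  ⇝-xc v d d≢1 = reach-a d v d≢1 ⨾ reach-x gA v ⨾ reach-a (x̄ (xa v) gA) (xc v) (x̄-a≢one (xa v))
    where
    x̄-a≢one : ∀ s → x̄ s gA ≢ one
    x̄-a≢one false = λ ()
    x̄-a≢one true  = λ ()

  ⇝-τc : ∀ v → v ⇝ τc v
  ⇝-τc v d d≢1 = reach-a d v d≢1 ⨾ reach-a-b v ⨾
    reach-≡ (reach-y gB v ⨾ reach-a (ȳ gB) (τc v ⊕ 0ᵇ) (λ ())) (cong (gA ⊗_) (⊕-identityʳ (τc v)))

  ⇝-τc⊕δ : ∀ v → v ⇝ τc v ⊕ δ
  ⇝-τc⊕δ v d d≢1 = reach-a d v d≢1 ⨾ reach-y gA v ⨾ reach-a (ȳ gA) (τc v ⊕ δ) (λ ())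

  Translation : Bits N → Set
  Translation c = ∀ v → v ⇝ v ⊕ c

  translation-≡ : ∀ {c c′} → Translation c → c ≡ c′ → Translation c′
  translation-≡ tc refl = tc

  translation-0ᵇ : Translation 0ᵇ
  translation-0ᵇ v d d≢1 = reach-≡ (reach-a d v d≢1) (cong (gA ⊗_) (sym (⊕-identityʳ v)))

  translation-⊕ : ∀ {a b} → Translation a → Translation b → Translation (a ⊕ b)
  translation-⊕ {a} {b} ta tb v = ⇝-≡ (⇝-trans (ta v) (tb (v ⊕ a))) (⊕-assoc v a b)

  translation-xc : ∀ {c} → Translation c → Translation (xc c)
  translation-xc {c} tc v = ⇝-≡ (⇝-trans (⇝-xc v) (⇝-trans (tc (xc v)) (⇝-xc (xc v ⊕ c))))
    (trans (xc-⊕ (xc v) c) (cong (_⊕ xc c) (xc-involutive v)))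

  translation-τc : ∀ {c} → Translation c → Translation (τc c)
  translation-τc {c} tc v = ⇝-≡ (⇝-trans (⇝-τc v) (⇝-trans (tc (τc v)) (⇝-τc (τc v ⊕ c))))
    (trans (τc-⊕ (τc v) c) (cong (_⊕ τc c) (τc-involutive v)))

  translation-δ : Translation δ
  translation-δ v = ⇝-≡ (⇝-trans (⇝-τc v) (⇝-τc⊕δ (τc v))) (cong (_⊕ δ) (τc-involutive v))

  translation-linComb : ∀ {r} (c : Fin r → Bits N) → (∀ i → Translation (c i)) →
                        ∀ w → Translation (linComb c w)
  translation-linComb c tc []          = translation-0ᵇ
  translation-linComb c tc (true ∷ w)  = translation-⊕ (tc 0F) (translation-linComb (c ∘ Fin.suc) (tc ∘ Fin.suc) w)
  translation-linComb c tc (false ∷ w) = translation-linComb (c ∘ Fin.suc) (tc ∘ Fin.suc) w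

  -- The odd generators are reached downwards from c_{2p-1} = δ ⊕ xc δ, the even ones
  -- upwards from c_2 = τc c_1, and c_{m-3} from δ.
  translation-o-highest : ∀ {q} → suc q ≡ p → Translation (o q)
  translation-o-highest {q} refl =
    translation-≡ (translation-⊕ translation-δ (translation-xc translation-δ)) (begin
      δ ⊕ xc δ
        ≡⟨ cong (λ t → t ⊕ xc t) (δ≡o⊕e⊕last refl) ⟩
      t ⊕ xc t
        ≡⟨ cong (t ⊕_) (trans (xc-⊕ (o q ⊕ e q) (o p)) (cong₂ _⊕_ (xc-⊕ (o q) (e q)) xc-last)) ⟩
      t ⊕ (xc (o q) ⊕ xc (e q) ⊕ o p)
        ≡⟨ cong (λ w → t ⊕ (w ⊕ o p)) (cong₂ _⊕_ (xc-o (n<1+n q)) (xc-e (n<1+n q))) ⟩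
      t ⊕ (o q ⊕ (o q ⊕ e q) ⊕ o p)
        ≡⟨ solve 3 (λ a b c → ((a ⊞ b) ⊞ c) ⊞ ((a ⊞ (a ⊞ b)) ⊞ c) ⊜ a) refl (o q) (e q) (o p) ⟩
      o q
        ∎)
    where
    t = o q ⊕ e q ⊕ o p

  translation-o-step : ∀ {j} → suc j < p → Translation (o (suc j)) → Translation (o j)
  translation-o-step {j} j+1<p to′ =
    translation-≡ (translation-⊕ (translation-⊕ τo′ (translation-xc τo′)) to′) (begin
      t ⊕ xc t ⊕ o (suc j)
        ≡⟨ cong (λ w → w ⊕ xc w ⊕ o (suc j)) (τc-o j+1<p) ⟩
      t′ ⊕ xc t′ ⊕ o (suc j)
        ≡⟨ cong (λ w → t′ ⊕ w ⊕ o (suc j))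
                (trans (xc-⊕ (o j ⊕ e j) (e (suc j))) (cong (_⊕ xc (e (suc j))) (xc-⊕ (o j) (e j)))) ⟩
      t′ ⊕ (xc (o j) ⊕ xc (e j) ⊕ xc (e (suc j))) ⊕ o (suc j)
        ≡⟨ cong (λ w → t′ ⊕ w ⊕ o (suc j)) (cong₂ _⊕_ (cong₂ _⊕_ (xc-o j<p) (xc-e j<p)) (xc-e j+1<p)) ⟩
      t′ ⊕ (o j ⊕ (o j ⊕ e j) ⊕ (o (suc j) ⊕ e (suc j))) ⊕ o (suc j)
        ≡⟨ solve 4 (λ a b c k → (((a ⊞ b) ⊞ k) ⊞ ((a ⊞ (a ⊞ b)) ⊞ (c ⊞ k))) ⊞ c ⊜ a) refl
                   (o j) (e j) (o (suc j)) (e (suc j)) ⟩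
      o j
        ∎)
    where
    j<p = <-trans (n<1+n j) j+1<p
    τo′ = translation-τc to′
    t   = τc (o (suc j))
    t′  = o j ⊕ e j ⊕ e (suc j)

  translation-o : ∀ {j} → j < p → Translation (o j)
  translation-o {j} j<p = below (p ∸ suc j) j (m∸n+n≡m j<p)
    where
    below : ∀ k j → k + suc j ≡ p → Translation (o j)
    below zero    j k+j+1≡p = translation-o-highest k+j+1≡p
    below (suc k) j k+j+1≡p = translation-o-step (subst (suc (suc j) ≤_) k+j+1≡p (s≤s (m≤n+m (suc j) k)))
                                                 (below k (suc j) (trans (+-suc k (suc j)) k+j+1≡p))

  translation-e : ∀ {j} → j < p → Translation (e j)
  translation-e {zero} 0<p = translation-≡ (translation-τc (translation-o 0<p))
    (trans (τc-o 0<p) (trans (cong (_⊕ e 0) (⊕-self (ĉ 0))) (⊕-identityˡ (e 0))))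
  translation-e {suc j} j+1<p =
    translation-≡
      (translation-⊕ (translation-⊕ (translation-τc (translation-o j+1<p)) (translation-o j<p)) (translation-e j<p))
      (trans (cong (λ w → w ⊕ o j ⊕ e j) (τc-o j+1<p))
             (solve 3 (λ a b c → (((a ⊞ b) ⊞ c) ⊞ a) ⊞ b ⊜ c) refl (o j) (e j) (e (suc j))))
    where j<p = <-trans (n<1+n j) j+1<p

  translation-oSum : ∀ q → q ≤ p → Translation (oSum q)
  translation-oSum zero    _     = translation-0ᵇ
  translation-oSum (suc q) q+1≤p = translation-⊕ (translation-oSum q (<⇒≤ q+1≤p)) (translation-o q+1≤p)

  translation-last : Translation (o p)
  translation-last = translation-≡ (translation-⊕ translation-δ (translation-⊕ ts (translation-τc ts)))
    (trans (cong (_⊕ (oSum p ⊕ τc (oSum p))) δ≡)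
           (solve 3 (λ a b c → ((a ⊞ b) ⊞ c) ⊞ (a ⊞ b) ⊜ c) refl (oSum p) (τc (oSum p)) (o p)))
    where ts = translation-oSum p ≤-refl

  every-translation : ∀ c → Translation c
  every-translation c = translation-≡ (translation-linComb unit basis c) (linComb-units c)
    where
    basis : ∀ i → Translation (unit i)
    basis i = translation-≡
      (on-basis {λ k → Translation (ĉ k)} translation-o translation-e translation-last (toℕ i) (toℕ<n i))
      (cv-cc-suc i)

-- The exceptional set U

evenBits : ∀ p → Bits (suc (double p)) → Bool
evenBits zero    _           = false
evenBits (suc p) (_ ∷ b ∷ w) = b xor evenBits p w

xa-evenBits : ∀ p v → Case.xa p v ≡ evenBits p v xor bit v (suc (double p))
xa-evenBits zero    (true ∷ [])  = refl
xa-evenBits zero    (false ∷ []) = refl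
xa-evenBits (suc p) (a ∷ b ∷ w)  = begin
  Case.xa (suc p) (a ∷ b ∷ w)                      ≡⟨ xa-∷∷ a b ⟩
  b xor Case.xa p w                                ≡⟨ cong (b xor_) (xa-evenBits p w) ⟩
  b xor (evenBits p w xor bit w (suc (double p)))  ≡⟨ xor-assoc b _ _ ⟨
  (b xor evenBits p w) xor bit w (suc (double p))  ∎
  where
  xa-∷∷ : ∀ a b → Case.xa (suc p) (a ∷ b ∷ w) ≡ b xor Case.xa p w
  xa-∷∷ false false = refl
  xa-∷∷ false true  = refl
  xa-∷∷ true  false = refl
  xa-∷∷ true  true  = refl

sum-evenBits : ∀ p v → sum (map (λ j → b2n (bit v (2 * suc j))) (upTo p)) % 2 ≡ b2n (evenBits p v)
sum-evenBits zero    _           = refl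
sum-evenBits (suc p) (a ∷ b ∷ w) = begin
  (b2n b + sum (map f (applyUpTo suc p))) % 2                  ≡⟨ cong (λ l → (b2n b + sum l) % 2) shift-indices ⟩
  (b2n b + sum (map f′ (upTo p))) % 2                          ≡⟨ %-distribˡ-+ (b2n b) _ 2 ⟩
  (b2n b % 2 + sum (map f′ (upTo p)) % 2) % 2                  ≡⟨ cong (λ k → (b2n b % 2 + k) % 2) (sum-evenBits p w) ⟩
  (b2n b % 2 + b2n (evenBits p w)) % 2                         ≡⟨ b2n-xor b (evenBits p w) ⟩
  b2n (b xor evenBits p w)                                     ∎
  where
  f f′ : ℕ → ℕ
  f  j = b2n (bit (a ∷ b ∷ w) (2 * suc j))
  f′ j = b2n (bit w (2 * suc j))
  shift-indices : map f (applyUpTo suc p) ≡ map f′ (upTo p)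
  shift-indices = begin
    map f (applyUpTo suc p)       ≡⟨ map-applyUpTo suc f p ⟩
    applyUpTo (f ∘ suc) p         ≡⟨ map-applyUpTo (λ j → j) (f ∘ suc) p ⟨
    map (f ∘ suc) (upTo p)        ≡⟨ map-cong (λ j → cong (b2n ∘ bit (a ∷ b ∷ w)) (*-suc 2 (suc j))) (upTo p) ⟩
    map f′ (upTo p)               ∎
  b2n-xor : ∀ x y → (b2n x % 2 + b2n y) % 2 ≡ b2n (x xor y)
  b2n-xor false false = refl
  b2n-xor false true  = refl
  b2n-xor true  false = refl
  b2n-xor true  true  = refl

condU-from-xa : ∀ p v → Case.xa p v ≡ false → condU (Case.m p) v
condU-from-xa p v xa≡false = begin
  evenSum (double p / 2)             ≡⟨ cong evenSum (double-/2 p) ⟩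
  evenSum p                          ≡⟨ sum-evenBits p v ⟩
  b2n (evenBits p v)                 ≡⟨ cong b2n (xor-≡-false (trans (sym (xa-evenBits p v)) xa≡false)) ⟩
  b2n (bit v (suc (double p)))       ≡⟨ b2n-%2 _ ⟩
  b2n (bit v (suc (double p))) % 2   ∎
  where
  evenSum : ℕ → ℕ
  evenSum q = sum (map (λ j → b2n (bit v (2 * suc j))) (upTo q)) % 2
  xor-≡-false : ∀ {x y} → x xor y ≡ false → x ≡ y
  xor-≡-false {false} {false} _ = refl
  xor-≡-false {true}  {true}  _ = refl
  b2n-%2 : ∀ x → b2n x ≡ b2n x % 2
  b2n-%2 false = refl
  b2n-%2 true  = refl

prodC-cgen : ∀ m v → prodC (cgen m) v ≡ one ⊗ v
prodC-cgen m v = begin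
  prodC (cgen m) v
    ≡⟨ prodC-central (cgen m) (λ _ → false) (cv ∘ cgen m) (λ _ → refl) v ⟩
  central (Parity.linComb (λ _ → false) v) (linComb (cv ∘ cgen m) v)
    ≡⟨ cong₂ central (Parity.linComb-ε v) (trans (linComb-cong cv-cc-suc v) (linComb-units v)) ⟩
  one ⊗ v
    ∎

module _ (p : ℕ) where
  open Case p
  open Bitwise.Solver

  reach-h-from-nonidentity : ∀ d v → d ≢ one → Reach (d ⊗ v) (hh m)
  reach-h-from-nonidentity d v d≢1 = reach-≡ (every-translation (v ⊕ u) v d d≢1)
    (trans (cong (gA ⊗_) (solve 2 (λ a b → a ⊞ (a ⊞ b) ⊜ b) refl v u)) (sym hh≡))

  reach-h-from-C : ∀ v → ¬ InU m (one ⊗ v) → ∀ s → xa v ≡ s → Reach (one ⊗ v) (hh m)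
  reach-h-from-C v v∉U false xa≡false = ⊥-elim (v∉U (v , condU-from-xa p v xa≡false , sym (prodC-cgen m v)))
  reach-h-from-C v v∉U true  xa≡true  =
    reach-x one v ⨾ reach-h-from-nonidentity (x̄ (xa v) one) (xc v) (subst (λ s → x̄ s one ≢ one) (sym xa≡true) (λ ()))

  reach-h : ∀ g → ¬ InU m g → Reach g (hh m)
  reach-h ⟪ 0F , false , v ⟫ g∉U = reach-h-from-C v g∉U (xa v) refl
  reach-h g@(⟪ 0F , true , v ⟫) _ = reach-h-from-nonidentity (d8 g) v (λ ())
  reach-h g@(⟪ 1F , _    , v ⟫) _ = reach-h-from-nonidentity (d8 g) v (λ ())
  reach-h g@(⟪ 2F , _    , v ⟫) _ = reach-h-from-nonidentity (d8 g) v (λ ())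
  reach-h g@(⟪ 3F , _    , v ⟫) _ = reach-h-from-nonidentity (d8 g) v (λ ())

even≥4⇒≡2p+4 : ∀ m → 4 ≤ m → 2 ∣ m → Σ ℕ (λ p → m ≡ Case.m p)
even≥4⇒≡2p+4 _ (s≤s (s≤s ())) (divides 1 refl)
even≥4⇒≡2p+4 _ _ (divides (suc (suc r)) refl) = r , cong (suc ∘ suc ∘ suc ∘ suc) (*2≡double r)
  where
  *2≡double : ∀ r → r * 2 ≡ double r
  *2≡double zero    = refl
  *2≡double (suc r) = cong (suc ∘ suc) (*2≡double r)

lemma3p10 : (m : ℕ) → 4 ≤ m → 2 ∣ m → (g : HH m) → ¬ InU m g →
            Σ (HH m → HH m) (λ ζ → InXYZ m ζ × ζ g ≡ hh m)
lemma3p10 m 4≤m 2∣m g g∉U with even≥4⇒≡2p+4 m 4≤m 2∣m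
... | p , refl = reach-h p g g∉U
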